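{- Let $(G,\Gamma)$ be a Hecke pair. The intersection of two congruence subgroups of $\Gamma$ is a congruence subgroup of $\Gamma$.
   Context: A Hecke pair $(G,\Gamma)$: $G$ a group, $\Gamma$ a subgroup with $\Gamma g\Gamma/\Gamma$ finite for all $g\in G$. For a finite-index normal subgroup $\Sigma$ of $\Gamma$ and $g\in G$, $\Sigma(g)$ denotes the kernel of the action of $\Sigma$ by left multiplication on the finite set $\Gamma g\Gamma/\Sigma$; it is again a finite-index normal subgroup of $\Gamma$ (equal to $\bigcap_{\gamma\in\Gamma}\gamma(\Sigma\cap g\Sigma g^{ -1})\gamma^{ -1}$). Iterating, for $g_1,\dots,g_n\in G$ one obtains $\Gamma(g_1)(g_2)\cdots(g_n)$, where $\Gamma(g_1)$ is formed from $\Sigma=\Gamma$, then $\Gamma(g_1)(g_2)=(\Gamma(g_1))(g_2)$, etc. A subgroup $\Sigma$ of $\Gamma$ is a congruence subgroup if it contains $\Gamma(g_1)(g_2)\cdots(g_n)$ for some $n\ge1$ and $g_1,\dots,g_n\in G$. -}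

module Defs where

open import Level using (_⊔_)
open import Algebra.Bundles using (Group)
open import Data.Product using (Σ; ∃; ∃-syntax; _×_; _,_)
open import Data.List using (List; []; _∷_)
open import Data.List.NonEmpty using (List⁺; _∷_)
open import Data.List.Relation.Unary.Any using (Any)
open import Relation.Unary using (Pred; _⊆_; _∩_)

-- Subsets of G are predicates of level c ⊔ ℓ (closed under the constructions below).
module HeckeDefs {c ℓ} (G : Group c ℓ) where
  open Group G

  Subset : Set (Level.suc (c ⊔ ℓ))
  Subset = Pred Carrier (c ⊔ ℓ)

  record IsSubgroup (H : Subset) : Set (c ⊔ ℓ) where
    field
      resp   : ∀ {x y} → x ≈ y → H x → H y
      ε∈     : H ε
      ∙-closed : ∀ {x y} → H x → H y → H (x ∙ y)
      ⁻¹-closed : ∀ {x} → H x → H (x ⁻¹)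

  DoubleCoset : Subset → Carrier → Subset
  DoubleCoset Γ g x = ∃[ a ] ∃[ b ] (Γ a × Γ b × x ≈ (a ∙ g) ∙ b)

  -- (G , Γ) is a Hecke pair: Γ is a subgroup and every Γ g Γ / Γ is finite,
  -- i.e. Γ g Γ is covered by finitely many left cosets y Γ.
  record HeckePair (Γ : Subset) : Set (c ⊔ ℓ) where
    field
      subgroup : IsSubgroup Γ
      finite   : ∀ g → ∃[ ys ] (∀ x → DoubleCoset Γ g x →
                   Any (λ y → Γ ((y ⁻¹) ∙ x)) ys)

  -- Σ(g): the kernel of the action of Σ by left multiplication on Γ g Γ / Σ.
  -- σ fixes the coset x Σ iff x⁻¹ σ x ∈ Σ.
  Ker : Subset → Subset → Carrier → Subset
  Ker Γ S g σ = S σ × (∀ x → DoubleCoset Γ g x → S (((x ⁻¹) ∙ σ) ∙ x))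

  iterKer : Subset → Subset → List Carrier → Subset
  iterKer Γ S []       = S
  iterKer Γ S (g ∷ gs) = iterKer Γ (Ker Γ S g) gs

  ΓOf : Subset → List⁺ Carrier → Subset
  ΓOf Γ (g ∷ gs) = iterKer Γ Γ (g ∷ gs)

  record IsCongruenceSubgroup (Γ S : Subset) : Set (Level.suc (c ⊔ ℓ)) where
    field
      subgroup : IsSubgroup S
      S⊆Γ      : S ⊆ Γ
      gens     : List⁺ Carrier
      contains : ΓOf Γ gens ⊆ S

{-# OPTIONS --safe #-}
module Submission where

-- Passing to a kernel only shrinks a subgroup, and monotonically so. Hence
-- Γ(g₁)⋯(gₙ)(h₁)⋯(hₘ), which is Γ(g₁)⋯(gₙ) with further kernels taken, lies in
-- Γ(g₁)⋯(gₙ), and it lies in Γ(h₁)⋯(hₘ) because Γ(g₁)⋯(gₙ) ⊆ Γ. So if S₁ and S₂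
-- contain these two subgroups, S₁ ∩ S₂ contains the one for the concatenated list.

open import Defs
open import Level using (_⊔_)
open import Algebra.Bundles using (Group)
open import Relation.Unary using (Pred; _∩_; _⊆_)
open import Relation.Binary.PropositionalEquality using (_≡_; refl; subst)
open import Data.Product using (_,_; proj₁)
open import Data.List using ([]; _∷_; _++_)
open import Data.List.NonEmpty using (_∷_; _⁺++⁺_)

module CongruenceSubgroups {c ℓ} (G : Group c ℓ) where
  open HeckeDefs G

  Ker-mono : ∀ Γ {S T} g → S ⊆ T → Ker Γ S g ⊆ Ker Γ T g
  Ker-mono Γ g S⊆T (σ∈S , fixes) = S⊆T σ∈S , λ x x∈ΓgΓ → S⊆T (fixes x x∈ΓgΓ)

  iterKer-mono : ∀ Γ {S T} gs → S ⊆ T → iterKer Γ S gs ⊆ iterKer Γ T gs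
  iterKer-mono Γ []               S⊆T = S⊆T
  iterKer-mono Γ {S} {T} (g ∷ gs) S⊆T =
    iterKer-mono Γ {Ker Γ S g} {Ker Γ T g} gs (Ker-mono Γ {S} {T} g S⊆T)

  iterKer-⊆ : ∀ Γ S gs → iterKer Γ S gs ⊆ S
  iterKer-⊆ Γ S []       σ∈S = σ∈S
  iterKer-⊆ Γ S (g ∷ gs) σ∈  = proj₁ (iterKer-⊆ Γ (Ker Γ S g) gs σ∈)

  iterKer-++ : ∀ Γ S gs hs → iterKer Γ S (gs ++ hs) ≡ iterKer Γ (iterKer Γ S gs) hs
  iterKer-++ Γ S []       hs = refl
  iterKer-++ Γ S (g ∷ gs) hs = iterKer-++ Γ (Ker Γ S g) gs hs

  ΓOf-⁺++⁺ : ∀ Γ gs hs → ΓOf Γ (gs ⁺++⁺ hs) ⊆ ΓOf Γ gs ∩ ΓOf Γ hs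
  ΓOf-⁺++⁺ Γ (g ∷ gs) (h ∷ hs) {σ} σ∈ =
      iterKer-⊆ Γ (ΓOf Γ (g ∷ gs)) (h ∷ hs) σ∈′
    , iterKer-mono Γ (h ∷ hs) (iterKer-⊆ Γ Γ (g ∷ gs)) σ∈′
    where
    σ∈′ : iterKer Γ (ΓOf Γ (g ∷ gs)) (h ∷ hs) σ
    σ∈′ = subst (λ P → P σ) (iterKer-++ Γ Γ (g ∷ gs) (h ∷ hs)) σ∈

  ∩-isSubgroup : ∀ {S T} → IsSubgroup S → IsSubgroup T → IsSubgroup (S ∩ T)
  ∩-isSubgroup S≤G T≤G = record
    { resp      = λ x≈y (x∈S , x∈T) → S.resp x≈y x∈S , T.resp x≈y x∈T
    ; ε∈        = S.ε∈ , T.ε∈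
    ; ∙-closed  = λ (x∈S , x∈T) (y∈S , y∈T) → S.∙-closed x∈S y∈S , T.∙-closed x∈T y∈T
    ; ⁻¹-closed = λ (x∈S , x∈T) → S.⁻¹-closed x∈S , T.⁻¹-closed x∈T
    }
    where
    module S = IsSubgroup S≤G
    module T = IsSubgroup T≤G

lemma1p2p4 : ∀ {c ℓ} (G : Group c ℓ) (Γ S₁ S₂ : Pred (Group.Carrier G) (c ⊔ ℓ)) →
    HeckeDefs.HeckePair G Γ →
    HeckeDefs.IsCongruenceSubgroup G Γ S₁ →
    HeckeDefs.IsCongruenceSubgroup G Γ S₂ →
    HeckeDefs.IsCongruenceSubgroup G Γ (S₁ ∩ S₂)
-- The finiteness of Γ g Γ / Γ is only needed for Σ(g) to have finite index, which
-- the definition of a congruence subgroup does not record.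
lemma1p2p4 G Γ S₁ S₂ _ C₁ C₂ = record
  { subgroup = ∩-isSubgroup C₁.subgroup C₂.subgroup
  ; S⊆Γ      = λ (σ∈S₁ , _) → C₁.S⊆Γ σ∈S₁
  ; gens     = C₁.gens ⁺++⁺ C₂.gens
  ; contains = λ σ∈ → let (σ∈Γ₁ , σ∈Γ₂) = ΓOf-⁺++⁺ Γ C₁.gens C₂.gens σ∈
                      in C₁.contains σ∈Γ₁ , C₂.contains σ∈Γ₂
  }
  where
  open HeckeDefs G
  open CongruenceSubgroups G
  module C₁ = IsCongruenceSubgroup C₁
  module C₂ = IsCongruenceSubgroup C₂
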